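{- Let $k\ge1$ be an integer and $x\ge p_k$. For every $y\ge x$, the interval $(\eta_k(x)\,y,\;y]$ contains at least $k$ primes; and $\eta_k(x)$ is the largest real $\lambda$ such that $(\lambda y,y]$ contains at least $k$ primes for every $y\ge x$.
   Context: $p_i$ denotes the $i$-th prime ($p_1=2$). For an integer $k\ge1$ and real $x\ge p_k$, $\eta_k(x)=\min\left\{\dfrac{p_{i-k}}{p_i}: p_i>x\right\}$. $(a,b]$ denotes the interval open at $a$ and closed at $b$.
   Formalization: The numbers x and y and the candidate λ in the maximality claim range over the rationals instead of the reals. -}

module Defs where

open import Data.Nat as ℕ using (ℕ; zero; suc)
open import Data.Nat.Primality using (Prime; prime?)
open import Data.Integer using (+_)
open import Data.Rational as ℚ using (ℚ; _/_; _<_; _≤_; _*_)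
open import Data.List using (length; filter; upTo)
open import Data.Fin using (Fin)
open import Data.Product using (Σ; ∃; _×_)
open import Function.Definitions using (Injective)
open import Relation.Binary.PropositionalEquality using (_≡_)

toℚ : ℕ → ℚ
toℚ n = + n / 1

-- total division of naturals into ℚ (junk value 0 for denominator 0;
-- only ever used with prime denominators)
ratio : ℕ → ℕ → ℚ
ratio q zero = + 0 / 1
ratio q (suc n) = + q / suc n

primeCount : ℕ → ℕ
primeCount n = length (filter prime? (upTo (suc n)))

-- NthPrime i p  ⇔  p = p_i  (p_1 = 2)
NthPrime : ℕ → ℕ → Set
NthPrime i p = Prime p × primeCount p ≡ i

AtLeastPrimesIn : ℕ → ℚ → ℚ → Set
AtLeastPrimesIn k a b =
  Σ (Fin k → ℕ) λ f → Injective _≡_ _≡_ f ×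
    (∀ j → Prime (f j) × a < toℚ (f j) × toℚ (f j) ≤ b)

-- IsEta k x η  ⇔  η = η_k(x) = min { p_{i-k} / p_i : p_i > x }
IsEta : ℕ → ℚ → ℚ → Set
IsEta k x η =
  (∃ λ i → ∃ λ p → ∃ λ q → NthPrime i p × NthPrime (i ℕ.∸ k) q ×
      x < toℚ p × η ≡ ratio q p)
  × (∀ i p q → NthPrime i p → NthPrime (i ℕ.∸ k) q → x < toℚ p →
      η ≤ ratio q p)

{-# OPTIONS --safe #-}
-- Index primes by the prime-counting function π, so that p_i is the prime with π(p_i) = i.
-- For y ≥ x put n = ⌊y⌋ and j = π(n) ≥ k.  The next prime p_{j+1} exceeds y ≥ x, so
-- p_{j+1-k}/p_{j+1} competes in the minimum defining η_k(x) and η_k(x) y < p_{j+1-k};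
-- hence p_{j+1-k}, …, p_j all lie in (η_k(x) y, y].  Conversely, let η_k(x) = p_{i-k}/p_i with
-- p_i > x and λ > η_k(x).  For y = max(x, p_{i-k}/λ) the interval (λy, y] lies strictly between
-- p_{i-k} and p_i, so the π-values of its primes lie strictly between i - k and i: at most k - 1 primes.
module Submission where

open import Defs
open import Data.Nat using (ℕ)

module PrimeCounting where

  open import Data.Nat
  open import Data.Nat.Properties
  open import Data.Nat.Divisibility using (_∣_; m∣m*n; m≤n⇒m!∣n!; ∣-trans; ∣m+n∣m⇒∣n; ∣1⇒≡1)
  open import Data.Nat.Primality using (Prime; prime?; prime⇒nonTrivial)
  open import Data.Nat.Primality.Factorisation using (factorise)
  open import Data.List using ([]; _∷_; [_]; length; filter; upTo; _++_)
  open import Data.List.Relation.Unary.All using (_∷_)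
  import Data.List.Properties as List
  open import Data.Fin using (Fin; toℕ; fromℕ<)
  open import Data.Fin.Properties using (toℕ-fromℕ<; toℕ-injective; toℕ<n; injective⇒≤)
  open import Data.Product using (Σ; ∃; _×_; _,_; proj₁; proj₂)
  open import Data.Sum using (inj₁; inj₂)
  open import Data.Empty using (⊥-elim)
  open import Function.Definitions using (Injective)
  open import Relation.Nullary using (¬_; yes; no)
  open import Relation.Binary.PropositionalEquality hiding ([_])
  open import Relation.Binary.Definitions using (tri<; tri≈; tri>)

  prime⇒1<p : ∀ {p} → Prime p → 1 < p
  prime⇒1<p {p} pr = nonTrivial⇒n>1 p {{prime⇒nonTrivial pr}}

  primeCount-suc : ∀ n → primeCount (suc n) ≡ primeCount n + length (filter prime? [ suc n ])
  primeCount-suc n = begin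
    length (filter prime? (upTo (suc (suc n))))
      ≡⟨ cong (λ l → length (filter prime? l)) (sym (List.upTo-∷ʳ (suc n))) ⟩
    length (filter prime? (upTo (suc n) ++ [ suc n ]))
      ≡⟨ cong length (List.filter-++ prime? (upTo (suc n)) [ suc n ]) ⟩
    length (filter prime? (upTo (suc n)) ++ filter prime? [ suc n ])
      ≡⟨ List.length-++ (filter prime? (upTo (suc n))) ⟩
    primeCount n + length (filter prime? [ suc n ]) ∎
    where open ≡-Reasoning

  primeCount-suc-prime : ∀ {n} → Prime (suc n) → primeCount (suc n) ≡ suc (primeCount n)
  primeCount-suc-prime {n} pr = begin
    primeCount (suc n)
      ≡⟨ primeCount-suc n ⟩
    primeCount n + length (filter prime? [ suc n ])
      ≡⟨ cong (λ l → primeCount n + length l) (List.filter-accept prime? {xs = []} pr) ⟩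
    primeCount n + 1
      ≡⟨ +-comm (primeCount n) 1 ⟩
    suc (primeCount n) ∎
    where open ≡-Reasoning

  primeCount-suc-¬prime : ∀ {n} → ¬ Prime (suc n) → primeCount (suc n) ≡ primeCount n
  primeCount-suc-¬prime {n} ¬pr = begin
    primeCount (suc n)
      ≡⟨ primeCount-suc n ⟩
    primeCount n + length (filter prime? [ suc n ])
      ≡⟨ cong (λ l → primeCount n + length l) (List.filter-reject prime? {xs = []} ¬pr) ⟩
    primeCount n + 0
      ≡⟨ +-identityʳ (primeCount n) ⟩
    primeCount n ∎
    where open ≡-Reasoning

  primeCount-mono-≤ : ∀ {m n} → m ≤ n → primeCount m ≤ primeCount n
  primeCount-mono-≤ {m} {zero} z≤n = ≤-refl
  primeCount-mono-≤ {m} {suc n} m≤1+n with m≤n⇒m<n∨m≡n m≤1+n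
  ... | inj₂ refl = ≤-refl
  ... | inj₁ (s≤s m≤n) = begin
    primeCount m                                    ≤⟨ primeCount-mono-≤ m≤n ⟩
    primeCount n                                    ≤⟨ m≤m+n (primeCount n) _ ⟩
    primeCount n + length (filter prime? [ suc n ]) ≡⟨ primeCount-suc n ⟨
    primeCount (suc n)                              ∎
    where open ≤-Reasoning

  primeCount-mono-<-prime : ∀ {m n} → Prime n → m < n → primeCount m < primeCount n
  primeCount-mono-<-prime {m} {suc n} pr (s≤s m≤n) = begin-strict
    primeCount m        ≤⟨ primeCount-mono-≤ m≤n ⟩
    primeCount n        <⟨ n<1+n (primeCount n) ⟩
    suc (primeCount n)  ≡⟨ primeCount-suc-prime pr ⟨
    primeCount (suc n)  ∎
    where open ≤-Reasoning

  primeCount-injective-on-primes : ∀ {m n} → Prime m → Prime n → primeCount m ≡ primeCount n → m ≡ n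
  primeCount-injective-on-primes {m} {n} pm pn eq with <-cmp m n
  ... | tri≈ _ m≡n _ = m≡n
  ... | tri< m<n _ _ = ⊥-elim (<-irrefl eq (primeCount-mono-<-prime pn m<n))
  ... | tri> _ _ n<m = ⊥-elim (<-irrefl (sym eq) (primeCount-mono-<-prime pm n<m))

  nthPrime-exists : ∀ {i} n → 1 ≤ i → i ≤ primeCount n → ∃ λ p → NthPrime i p × p ≤ n
  nthPrime-exists zero 1≤i i≤0 = ⊥-elim (<-irrefl refl (≤-trans 1≤i i≤0))
  nthPrime-exists (suc n) 1≤i i≤π[1+n] with prime? (suc n)
  ... | no ¬pr =
    let p , p-nth , p≤n = nthPrime-exists n 1≤i (≤-trans i≤π[1+n] (≤-reflexive (primeCount-suc-¬prime ¬pr)))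
    in p , p-nth , m≤n⇒m≤1+n p≤n
  ... | yes pr with m≤n⇒m<n∨m≡n (≤-trans i≤π[1+n] (≤-reflexive (primeCount-suc-prime pr)))
  ...   | inj₂ refl = suc n , (pr , primeCount-suc-prime pr) , ≤-refl
  ...   | inj₁ (s≤s i≤πn) =
    let p , p-nth , p≤n = nthPrime-exists n 1≤i i≤πn
    in p , p-nth , m≤n⇒m≤1+n p≤n

  nthPrime-mono-≤ : ∀ {i j p q} → NthPrime i p → NthPrime j q → i ≤ j → p ≤ q
  nthPrime-mono-≤ {i} {j} {p} {q} (pr , πp≡i) (qr , πq≡j) i≤j with ≤-<-connex p q
  ... | inj₁ p≤q = p≤q
  ... | inj₂ q<p = ⊥-elim (<-irrefl refl (<-≤-trans
          (subst₂ _<_ πq≡j πp≡i (primeCount-mono-<-prime pr q<p)) i≤j))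

  nthPrime-index-positive : ∀ {i p} → NthPrime i p → 1 ≤ i
  nthPrime-index-positive {i} {p} (pr , πp≡i) =
    subst (1 ≤_) πp≡i (primeCount-mono-<-prime pr (prime⇒1<p pr))

  nthPrime-index-∸⇒< : ∀ {i k q} → NthPrime (i ∸ k) q → k < i
  nthPrime-index-∸⇒< q-nth = m∸n≢0⇒n<m (λ eq → <-irrefl (sym eq) (nthPrime-index-positive q-nth))

  d∣n! : ∀ {d n} → 1 ≤ d → d ≤ n → d ∣ n !
  d∣n! {suc d} _ d<n = ∣-trans (m∣m*n (d !)) (m≤n⇒m!∣n! d<n)

  -- Euclid: any prime factor of n! + 1 exceeds n.
  prime-> : ∀ n → ∃ λ p → Prime p × n < p
  prime-> n with factorise (suc (n !))
  ... | record { factors = [] ; isFactorisation = n!+1≡1 } =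
    ⊥-elim (<-irrefl (sym (suc-injective n!+1≡1)) (1≤n! n))
  ... | record { factors = p ∷ ps ; isFactorisation = eq ; factorsPrime = pr ∷ _ } =
    p , pr , ≰⇒> p≰n
    where
      p∣n!+1 : p ∣ n ! + 1
      p∣n!+1 = subst (p ∣_) (trans (sym eq) (+-comm 1 (n !))) (m∣m*n _)
      p≰n : ¬ p ≤ n
      p≰n p≤n = <-irrefl (sym (∣1⇒≡1 (∣m+n∣m⇒∣n p∣n!+1 (d∣n! (<⇒≤ (prime⇒1<p pr)) p≤n))))
                         (prime⇒1<p pr)

  nextPrime : ∀ n → ∃ λ p → NthPrime (suc (primeCount n)) p × n < p
  nextPrime n =
    let P , P-prime , n<P = prime-> n
        p , p-nth , _ = nthPrime-exists P (s≤s z≤n) (primeCount-mono-<-prime P-prime n<P)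
        p≰n : ¬ p ≤ n
        p≰n p≤n = <-irrefl refl (≤-trans (≤-reflexive (sym (proj₂ p-nth))) (primeCount-mono-≤ p≤n))
    in p , p-nth , ≰⇒> p≰n

  consecutivePrimes : ∀ k n i → 1 ≤ i → i + k ≤ suc (primeCount n) →
    Σ (Fin k → ℕ) λ f → Injective _≡_ _≡_ f × (∀ t → NthPrime (i + toℕ t) (f t) × f t ≤ n)
  consecutivePrimes k n i 1≤i i+k≤ = f , f-injective , λ t → proj₂ (prime t)
    where
      prime : ∀ t → ∃ λ p → NthPrime (i + toℕ t) p × p ≤ n
      prime t = nthPrime-exists n (≤-trans 1≤i (m≤m+n i _))
                  (≤-pred (≤-trans (+-monoʳ-< i (toℕ<n t)) i+k≤))
      f : Fin k → ℕ
      f t = proj₁ (prime t)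
      f-injective : Injective _≡_ _≡_ f
      f-injective {t} {u} ft≡fu = toℕ-injective (+-cancelˡ-≡ i _ _ (begin
        i + toℕ t           ≡⟨ proj₂ (proj₁ (proj₂ (prime t))) ⟨
        primeCount (f t)    ≡⟨ cong primeCount ft≡fu ⟩
        primeCount (f u)    ≡⟨ proj₂ (proj₁ (proj₂ (prime u))) ⟩
        i + toℕ u           ∎))
        where open ≡-Reasoning

  distinctPrimes-countIn-≤ : ∀ k lo m (f : Fin k → ℕ) → Injective _≡_ _≡_ f →
    (∀ t → Prime (f t) × lo < primeCount (f t) × primeCount (f t) ≤ lo + m) → k ≤ m
  distinctPrimes-countIn-≤ k lo m f f-injective bounds = injective⇒≤ {f = slot} slot-injective
    where
      c : Fin k → ℕ
      c t = primeCount (f t)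
      offset<m : ∀ t → c t ∸ suc lo < m
      offset<m t = let _ , lo<c , c≤lo+m = bounds t in begin-strict
        c t ∸ suc lo        <⟨ n<1+n _ ⟩
        suc (c t ∸ suc lo)  ≡⟨ +-∸-assoc 1 lo<c ⟨
        c t ∸ lo            ≤⟨ ∸-monoˡ-≤ lo c≤lo+m ⟩
        lo + m ∸ lo         ≡⟨ m+n∸m≡n lo m ⟩
        m                   ∎
        where open ≤-Reasoning
      slot : Fin k → Fin m
      slot t = fromℕ< (offset<m t)
      slot-injective : Injective _≡_ _≡_ slot
      slot-injective {t} {u} slot≡ = f-injective (primeCount-injective-on-primes
        (proj₁ (bounds t)) (proj₁ (bounds u))
        (∸-cancelʳ-≡ (proj₁ (proj₂ (bounds t))) (proj₁ (proj₂ (bounds u)))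
          (trans (sym (toℕ-fromℕ< (offset<m t))) (trans (cong toℕ slot≡) (toℕ-fromℕ< (offset<m u))))))

open PrimeCounting
open import Data.Nat as ℕ using (suc; z≤n; s≤s; _∸_; _+_)
import Data.Nat.Properties as ℕ
open import Data.Nat.DivMod using (_/_; _%_; m≡m%n+[m/n]*n; m%n<n; m/n*n≤m)
open import Data.Nat.Primality using (Prime; prime⇒nonZero)
open import Data.Integer as ℤ using (+_; -[1+_])
import Data.Integer.Properties as ℤ
open import Data.Rational as ℚ using (ℚ; mkℚ; _≤_; _<_; _*_; 0ℚ; 1ℚ; 1/_; *≤*)
import Data.Rational.Properties as ℚ
import Data.Rational.Unnormalised as ℚᵘ
import Data.Rational.Unnormalised.Properties as ℚᵘ
open import Data.Fin using (toℕ)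
open import Data.Product using (∃; _×_; _,_; proj₁; proj₂)
open import Data.Sum using (inj₁; inj₂; [_,_]′)
open import Data.Empty using (⊥-elim)
open import Relation.Nullary using (¬_)
open import Relation.Binary.PropositionalEquality

toℚᵘ-toℚ : ∀ n → ℚ.toℚᵘ (toℚ n) ℚᵘ.≃ ℚᵘ.mkℚᵘ (+ n) 0
toℚᵘ-toℚ n = ℚ.toℚᵘ-fromℚᵘ (ℚᵘ.mkℚᵘ (+ n) 0)

toℚ-mono-≤ : ∀ {m n} → m ℕ.≤ n → toℚ m ≤ toℚ n
toℚ-mono-≤ {m} {n} m≤n = ℚ.toℚᵘ-cancel-≤
  (ℚᵘ.≤-respˡ-≃ (ℚᵘ.≃-sym (toℚᵘ-toℚ m)) (ℚᵘ.≤-respʳ-≃ (ℚᵘ.≃-sym (toℚᵘ-toℚ n))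
    (ℚᵘ.*≤* (subst₂ ℤ._≤_ (sym (ℤ.*-identityʳ (+ m))) (sym (ℤ.*-identityʳ (+ n))) (ℤ.+≤+ m≤n)))))

toℚ-mono-< : ∀ {m n} → m ℕ.< n → toℚ m < toℚ n
toℚ-mono-< {m} {n} m<n = ℚ.toℚᵘ-cancel-<
  (ℚᵘ.<-respˡ-≃ (ℚᵘ.≃-sym (toℚᵘ-toℚ m)) (ℚᵘ.<-respʳ-≃ (ℚᵘ.≃-sym (toℚᵘ-toℚ n))
    (ℚᵘ.*<* (subst₂ ℤ._<_ (sym (ℤ.*-identityʳ (+ m))) (sym (ℤ.*-identityʳ (+ n))) (ℤ.+<+ m<n)))))

toℚ-cancel-< : ∀ m n → toℚ m < toℚ n → m ℕ.< n
toℚ-cancel-< m n m<n with ℕ.≤-<-connex n m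
... | inj₂ m<n′ = m<n′
... | inj₁ n≤m = ⊥-elim (ℚ.<-irrefl refl (ℚ.<-≤-trans m<n (toℚ-mono-≤ n≤m)))

ratio-*-toℚ : ∀ q p .{{_ : ℕ.NonZero p}} → ratio q p * toℚ p ≡ toℚ q
ratio-*-toℚ q (suc d) = ℚ.toℚᵘ-injective (begin
  ℚ.toℚᵘ (ratio q (suc d) * toℚ (suc d))
    ≈⟨ ℚ.toℚᵘ-homo-* (ratio q (suc d)) (toℚ (suc d)) ⟩
  ℚ.toℚᵘ (ratio q (suc d)) ℚᵘ.* ℚ.toℚᵘ (toℚ (suc d))
    ≈⟨ ℚᵘ.*-cong (ℚ.toℚᵘ-fromℚᵘ (ℚᵘ.mkℚᵘ (+ q) d)) (toℚᵘ-toℚ (suc d)) ⟩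
  ℚᵘ.mkℚᵘ (+ q) d ℚᵘ.* ℚᵘ.mkℚᵘ (+ suc d) 0
    ≈⟨ ℚᵘ.*≡* cross ⟩
  ℚᵘ.mkℚᵘ (+ q) 0
    ≈⟨ toℚᵘ-toℚ q ⟨
  ℚ.toℚᵘ (toℚ q) ∎)
  where
    open ℚᵘ.≃-Reasoning
    cross : (+ q ℤ.* + suc d) ℤ.* + 1 ≡ + q ℤ.* + suc (d ℕ.* 1)
    cross = trans (ℤ.*-identityʳ _) (cong (λ m → + q ℤ.* + suc m) (sym (ℕ.*-identityʳ d)))

ratio-pos : ∀ q p .{{_ : ℕ.NonZero p}} → 1 ℕ.≤ q → 0ℚ < ratio q p
ratio-pos q (suc d) 1≤q = ℚ.toℚᵘ-cancel-< (ℚᵘ.<-respʳ-≃ (ℚᵘ.≃-sym (ℚ.toℚᵘ-fromℚᵘ (ℚᵘ.mkℚᵘ (+ q) d)))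
  (ℚᵘ.*<* (subst₂ ℤ._<_ (sym (ℤ.*-zeroˡ (+ suc d))) (sym (ℤ.*-identityʳ (+ q))) (ℤ.+<+ 1≤q))))

floor-nonNeg : ∀ y → 0ℚ ≤ y → ∃ λ n → toℚ n ≤ y × y < toℚ (suc n)
floor-nonNeg (mkℚ -[1+ m ] d _) (*≤* ())
floor-nonNeg y@(mkℚ (+ m) d _) _ = n , n≤y , y<1+n
  where
    n = m / suc d
    n≤y : toℚ n ≤ y
    n≤y = ℚ.toℚᵘ-cancel-≤ (ℚᵘ.≤-respˡ-≃ (ℚᵘ.≃-sym (toℚᵘ-toℚ n))
      (ℚᵘ.*≤* (subst₂ ℤ._≤_ (ℤ.pos-* n (suc d)) (sym (ℤ.*-identityʳ (+ m))) (ℤ.+≤+ (m/n*n≤m m (suc d))))))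
    m<[1+n]*[1+d] : m ℕ.< suc n ℕ.* suc d
    m<[1+n]*[1+d] = begin-strict
      m                          ≡⟨ m≡m%n+[m/n]*n m (suc d) ⟩
      m % suc d + n ℕ.* suc d    <⟨ ℕ.+-monoˡ-< (n ℕ.* suc d) (m%n<n m (suc d)) ⟩
      suc d + n ℕ.* suc d        ∎
      where open ℕ.≤-Reasoning
    y<1+n : y < toℚ (suc n)
    y<1+n = ℚ.toℚᵘ-cancel-< (ℚᵘ.<-respʳ-≃ (ℚᵘ.≃-sym (toℚᵘ-toℚ (suc n)))
      (ℚᵘ.*<* (subst₂ ℤ._<_ (sym (ℤ.*-identityʳ (+ m))) (ℤ.pos-* (suc n) (suc d)) (ℤ.+<+ m<[1+n]*[1+d]))))

*-mono-≤-<-pos : ∀ {a r y P} → a ≤ r → 0ℚ < r → 0ℚ ≤ y → y < P → a * y < r * P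
*-mono-≤-<-pos {a} {r} {y} {P} a≤r 0<r 0≤y y<P = begin-strict
  a * y  ≤⟨ ℚ.*-monoʳ-≤-nonNeg y {{ℚ.nonNegative 0≤y}} a≤r ⟩
  r * y  <⟨ ℚ.*-monoʳ-<-pos r {{ℚ.positive 0<r}} y<P ⟩
  r * P  ∎
  where open ℚ.≤-Reasoning

-- The point is y = max(x, q / c).
∃y∶x≤y<P∧q≤c*y : ∀ {c q x P} → 0ℚ < c → q < c * P → x < P → ∃ λ y → x ≤ y × y < P × q ≤ c * y
∃y∶x≤y<P∧q≤c*y {c} {q} {x} {P} 0<c q<c*P x<P = [ use-z , use-x ]′ (ℚ.≤-total x z)
  where
    instance
      c-positive : ℚ.Positive c
      c-positive = ℚ.positive 0<c
      c-nonNegative : ℚ.NonNegative c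
      c-nonNegative = ℚ.nonNegative (ℚ.<⇒≤ 0<c)
      c-nonZero : ℚ.NonZero c
      c-nonZero = ℚ.pos⇒nonZero c
    z : ℚ
    z = q * 1/ c
    c*z≡q : c * z ≡ q
    c*z≡q = begin
      c * (q * 1/ c)    ≡⟨ ℚ.*-comm c z ⟩
      (q * 1/ c) * c    ≡⟨ ℚ.*-assoc q (1/ c) c ⟩
      q * (1/ c * c)    ≡⟨ cong (q *_) (ℚ.*-inverseˡ c) ⟩
      q * 1ℚ            ≡⟨ ℚ.*-identityʳ q ⟩
      q                 ∎
      where open ≡-Reasoning
    use-z : x ≤ z → ∃ λ y → x ≤ y × y < P × q ≤ c * y
    use-z x≤z = z , x≤z , ℚ.*-cancelˡ-<-nonNeg c (subst (_< c * P) (sym c*z≡q) q<c*P) ,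
                ℚ.≤-reflexive (sym c*z≡q)
    use-x : z ≤ x → ∃ λ y → x ≤ y × y < P × q ≤ c * y
    use-x z≤x = x , ℚ.≤-refl , x<P , subst (_≤ c * x) c*z≡q (ℚ.*-monoˡ-≤-nonNeg c z≤x)

floor-covers-nthPrime : ∀ {k pk y} → NthPrime k pk → toℚ pk ≤ y →
  ∃ λ n → toℚ n ≤ y × y < toℚ (suc n) × k ℕ.≤ primeCount n
floor-covers-nthPrime {k} {pk} {y} pk-nth pk≤y =
  let n , n≤y , y<1+n = floor-nonNeg y (ℚ.≤-trans (toℚ-mono-≤ {n = pk} z≤n) pk≤y)
      pk≤n = ℕ.≤-pred (toℚ-cancel-< pk (suc n) (ℚ.≤-<-trans pk≤y y<1+n))
  in n , n≤y , y<1+n , subst (ℕ._≤ primeCount n) (proj₂ pk-nth) (primeCount-mono-≤ pk≤n)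

consecutivePrimesIn : ∀ {k i q a b} n → NthPrime i q → i + k ℕ.≤ suc (primeCount n) →
  a < toℚ q → toℚ n ≤ b → AtLeastPrimesIn k a b
consecutivePrimesIn {k} {i} n q-nth i+k≤ a<q n≤b =
  let f , f-injective , f-props = consecutivePrimes k n i (nthPrime-index-positive q-nth) i+k≤
  in f , f-injective , λ t →
       let ft-nth , ft≤n = f-props t
       in proj₁ ft-nth ,
          ℚ.<-≤-trans a<q (toℚ-mono-≤ (nthPrime-mono-≤ q-nth ft-nth (ℕ.m≤m+n i (toℕ t)))) ,
          ℚ.≤-trans (toℚ-mono-≤ ft≤n) n≤b

lastPrimesUpTo : ∀ {k a b} n → 1 ℕ.≤ k → k ℕ.≤ primeCount n → toℚ n ≤ b →
  (∀ q → NthPrime (suc (primeCount n) ∸ k) q → a < toℚ q) → AtLeastPrimesIn k a b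
lastPrimesUpTo {k} n 1≤k k≤πn n≤b a<q =
  let q , q-nth , _ = nthPrime-exists n (ℕ.m<n⇒0<n∸m (s≤s k≤πn)) (ℕ.∸-monoʳ-≤ (suc (primeCount n)) 1≤k)
  in consecutivePrimesIn n q-nth (ℕ.≤-reflexive (ℕ.m∸n+n≡m (ℕ.m≤n⇒m≤1+n k≤πn))) (a<q q q-nth) n≤b

η-scaled-below : ∀ {k x η y j P q} → IsEta k x η → NthPrime j P → NthPrime (j ∸ k) q →
  x ≤ y → 0ℚ ≤ y → y < toℚ P → η * y < toℚ q
η-scaled-below {η = η} {y} {j} {P} {q} (_ , η-minimal) P-nth q-nth x≤y 0≤y y<P =
  subst (η * y <_) (ratio-*-toℚ q P)
    (*-mono-≤-<-pos (η-minimal j P q P-nth q-nth (ℚ.≤-<-trans x≤y y<P))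
      (ratio-pos q P (ℕ.<⇒≤ (prime⇒1<p (proj₁ q-nth)))) 0≤y y<P)
  where
    instance
      P-nonZero : ℕ.NonZero P
      P-nonZero = prime⇒nonZero (proj₁ P-nth)

η-interval-hasPrimes : ∀ {k x η} → 1 ℕ.≤ k → (∀ pk → NthPrime k pk → toℚ pk ≤ x) → IsEta k x η →
  ∀ y → x ≤ y → AtLeastPrimesIn k (η * y) y
η-interval-hasPrimes {k} 1≤k pk≤x η-isEta@((_ , p , _ , p-nth , q-nth , _ , _) , _) y x≤y =
  let k≤πp = subst (k ℕ.≤_) (sym (proj₂ p-nth)) (ℕ.<⇒≤ (nthPrime-index-∸⇒< q-nth))
      pk , pk-nth , _ = nthPrime-exists p 1≤k k≤πp
      n , n≤y , y<1+n , k≤πn = floor-covers-nthPrime pk-nth (ℚ.≤-trans (pk≤x pk pk-nth) x≤y)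
      P , P-nth , n<P = nextPrime n
  in lastPrimesUpTo n 1≤k k≤πn n≤y λ q q-nth →
       η-scaled-below {k = k} {y = y} η-isEta P-nth q-nth x≤y (ℚ.≤-trans (toℚ-mono-≤ {n = n} z≤n) n≤y)
         (ℚ.<-≤-trans y<1+n (toℚ-mono-≤ n<P))

¬atLeastPrimesIn-between : ∀ {k i p q a b} → 1 ℕ.≤ k → NthPrime i p → NthPrime (i ∸ k) q →
  toℚ q ≤ a → b < toℚ p → ¬ AtLeastPrimesIn k a b
¬atLeastPrimesIn-between {suc k} {i} {p} {q} (s≤s z≤n) p-nth q-nth q≤a b<p (f , f-injective , f-props) =
  ℕ.1+n≰n (distinctPrimes-countIn-≤ (suc k) (i ∸ suc k) k f f-injective bounds)
  where
    bounds : ∀ t → Prime (f t) × i ∸ suc k ℕ.< primeCount (f t) × primeCount (f t) ℕ.≤ i ∸ suc k + k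
    bounds t = ft-prime , lower , ℕ.≤-pred upper
      where
        ft-prime = proj₁ (f-props t)
        lower : i ∸ suc k ℕ.< primeCount (f t)
        lower = subst (ℕ._< primeCount (f t)) (proj₂ q-nth)
          (primeCount-mono-<-prime ft-prime (toℚ-cancel-< q (f t) (ℚ.≤-<-trans q≤a (proj₁ (proj₂ (f-props t))))))
        upper : primeCount (f t) ℕ.< suc (i ∸ suc k + k)
        upper = begin-strict
          primeCount (f t)
            <⟨ primeCount-mono-<-prime (proj₁ p-nth) (toℚ-cancel-< (f t) p (ℚ.≤-<-trans (proj₂ (proj₂ (f-props t))) b<p)) ⟩
          primeCount p         ≡⟨ proj₂ p-nth ⟩
          i                    ≡⟨ ℕ.m∸n+n≡m (ℕ.<⇒≤ (nthPrime-index-∸⇒< {k = suc k} q-nth)) ⟨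
          i ∸ suc k + suc k    ≡⟨ ℕ.+-suc (i ∸ suc k) k ⟩
          suc (i ∸ suc k + k)  ∎
          where open ℕ.≤-Reasoning

η-maximal : ∀ {k x η} → 1 ℕ.≤ k → IsEta k x η →
  (c : ℚ) → (∀ y → x ≤ y → AtLeastPrimesIn k (c * y) y) → c ≤ η
η-maximal 1≤k ((_ , p , q , p-nth , q-nth , x<p , η≡q/p) , _) c c-works = ℚ.≮⇒≥ λ η<c →
  let q/p<c = subst (_< c) η≡q/p η<c
      0<c = ℚ.<-trans (ratio-pos q p (ℕ.<⇒≤ (prime⇒1<p (proj₁ q-nth)))) q/p<c
      q<c*p = subst (_< c * toℚ p) (ratio-*-toℚ q p) (ℚ.*-monoˡ-<-pos (toℚ p) q/p<c)
      y , x≤y , y<p , q≤c*y = ∃y∶x≤y<P∧q≤c*y 0<c q<c*p x<p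
  in ¬atLeastPrimesIn-between 1≤k p-nth q-nth q≤c*y y<p (c-works y x≤y)
  where
    instance
      p-nonZero : ℕ.NonZero p
      p-nonZero = prime⇒nonZero (proj₁ p-nth)
      p-positive : ℚ.Positive (toℚ p)
      p-positive = ℚ.positive (toℚ-mono-< (ℕ.>-nonZero⁻¹ p))

mainTheorem11 : (k : ℕ) → 1 Data.Nat.≤ k → (x : ℚ) →
    (∀ pk → NthPrime k pk → toℚ pk ≤ x) →
    (η : ℚ) → IsEta k x η →
    ((y : ℚ) → x ≤ y → AtLeastPrimesIn k (η * y) y)
    × ((λ' : ℚ) → ((y : ℚ) → x ≤ y → AtLeastPrimesIn k (λ' * y) y) → λ' ≤ η)
mainTheorem11 k 1≤k x pk≤x η η-isEta = η-interval-hasPrimes 1≤k pk≤x η-isEta , η-maximal 1≤k η-isEta
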